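{- Let $A\subseteq[N]$ with $|A|=\delta N$ ($\delta>0$), and let $k\geqslant 2$ be an integer. Then there is an interval $J\subseteq[N]$ which is $k$-equidistributed (with respect to $A$ and $\delta$) and satisfies \[ |J|\geqslant N\cdot\exp\bigl(-4k\log(4k)\log(1/\delta)\bigr). \]
   Context: $[N]=\{1,\dots,N\}$ and intervals are sets of consecutive integers. Given $A\subseteq[N]$ with $|A|=\delta N$ and an integer $k\geqslant 2$, an interval $J\subseteq[N]$ is called $k$-equidistributed if $J$ can be decomposed into $k$ consecutive subintervals $J=J_1\sqcup\dots\sqcup J_k$ with $|J_i|\geqslant\lfloor|J|/k\rfloor$ such that $|A\cap J_i|\geqslant\delta|J_i|/2$ for all $i\in[k]$ (here $\delta=|A|/N$ is the density of $A$ in $[N]$, not in $J$). -}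

module Defs where

open import Data.Nat using (ℕ; zero; suc; _+_; _*_; _∸_; _^_; _≤_; _<_; _<?_; _/_)
open import Data.Nat.Combinatorics using (_P_)
open import Data.Nat.Properties using ()
open import Data.Fin using (Fin; fromℕ<)
open import Data.Fin.Subset using (Subset; ∣_∣; _∈_)
open import Data.Fin.Subset.Properties using (_∈?_)
open import Data.Vec using (Vec; []; _∷_)
open import Data.List using (List; map; upTo)
open import Data.Nat.ListAction using (sum)
open import Data.Product using (Σ; _×_; ∃-syntax)
open import Data.Unit using (⊤)
open import Data.Empty using (⊥)
open import Relation.Binary.PropositionalEquality using (_≡_)
open import Data.Nat using (_!)
open import Relation.Nullary using (yes; no)

-- Convention: [N] = {1,…,N} is encoded 0-indexed as Fin N (element x ∈ [N]
-- corresponds to x-1).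
-- An interval is encoded by its start a (0-indexed) and its length L,
-- i.e. {a, a+1, …, a+L-1}; it lies inside [N] iff a + L ≤ N.

-- cnt A a L = |A ∩ {a, …, a+L-1}|  (positions ≥ N are not in A)
cnt : {N : ℕ} → Subset N → ℕ → ℕ → ℕ
cnt {N} A a zero = 0
cnt {N} A a (suc L) with a <? N
... | no _ = cnt A (suc a) L
... | yes a<N with fromℕ< a<N ∈? A
...   | yes _ = suc (cnt A (suc a) L)
...   | no _ = cnt A (suc a) L

-- Good A m a ls : consecutive subintervals starting at a with lengths ls,
-- each of length ≥ m and with |A ∩ J_i| ≥ δ|J_i|/2 where δ = |A|/N,
-- i.e. |A| * |J_i| ≤ 2 * N * |A ∩ J_i|.
Good : {N k : ℕ} → Subset N → ℕ → ℕ → Vec ℕ k → Set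
Good A m a [] = ⊤
Good {N} A m a (l ∷ ls) =
  (m ≤ l) × (∣ A ∣ * l ≤ 2 * N * cnt A a l) × Good A m (a + l) ls

vsum : {k : ℕ} → Vec ℕ k → ℕ
vsum [] = 0
vsum (l ∷ ls) = l + vsum ls

-- The interval {a,…,a+L-1} is k-equidistributed w.r.t. A (and δ = |A|/N):
-- there are lengths |J_1|,…,|J_k| summing to L with |J_i| ≥ ⌊L/k⌋ and
-- |A ∩ J_i| ≥ δ|J_i|/2.  (k = 0 is never used: the theorem assumes k ≥ 2;
-- it is set to ⊥ only because ⌊L/0⌋ is undefined.)
Equidistributed : {N : ℕ} → Subset N → (k : ℕ) → ℕ → ℕ → Set
Equidistributed A zero a L = ⊥
Equidistributed A (suc k') a L =
  ∃[ ls ] (vsum {suc k'} ls ≡ L × Good A (L / suc k') a ls)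

-- ExpExceeds m p q  (q ≥ 1)  :  exp(p / (m q)) > m, expressed through the
-- partial sums of the exponential series: there is n with
--   Σ_{i=0}^{n} (p/(mq))^i / i!  >  m,
-- multiplied through by n! (mq)^n, using n!/i! = n P (n ∸ i).
-- With m = 4k this says p/q > 4k log(4k).
ExpExceeds : ℕ → ℕ → ℕ → Set
ExpExceeds m p q = ∃[ n ]
  (m * (n !) * (m * q) ^ n <
     sum (map (λ i → p ^ i * (m * q) ^ (n ∸ i) * (n P (n ∸ i))) (upTo (suc n))))

{-# OPTIONS --safe #-}

-- Density increment, with m = 4k, g = m - 1 and δ = |A|/N. Keep an interval J and a level j with
-- |A ∩ J| ≥ δ (m/g)^j |J| and |J| ≥ N / m^j, starting from J = [N] and j = 0. Cut J into k pieces
-- of length at least ⌊|J|/k⌋. Either some piece has density at least δ (m/g)^(j+1), and we pass to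
-- it, losing a factor at most m in length; or every piece has density at least δ/2, because a piece
-- below δ/2 while all the others stay below δ (m/g)^(j+1) would be no longer than 2|J|/m < ⌊|J|/k⌋.
-- Since densities are at most 1, δ ≤ (g/m)^j at the end. Comparing the exponential series with
-- powers of 1 + 1/K shows (m/g)^p ≥ m^q whenever exp(p/(mq)) > m, hence
-- (|J|/N)^q ≥ m^(-jq) ≥ (g/m)^(jp) ≥ δ^p.
module Submission where

open import Data.Bool.Base using (true; false; if_then_else_; T)
open import Data.Fin.Base using (fromℕ<)
open import Data.Fin.Subset using (Subset; ∣_∣; _∈_)
open import Data.Fin.Subset.Properties using (_∈?_)
open import Data.List.Base using (map; upTo; applyUpTo; [_]; _++_)
open import Data.List.Properties using (map-applyUpTo; applyUpTo-∷ʳ)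
open import Data.Nat.Base
open import Data.Nat.Combinatorics using (_P_)
open import Data.Nat.Combinatorics.Base using (_P′_)
open import Data.Nat.Combinatorics.Specification using (nP′k≡n[n∸1P′k∸1])
open import Data.Nat.DivMod using (m≡m%n+[m/n]*n; m%n<n; m/n*n≤m; m<n⇒m/n≡0; m≥n⇒m/n>0)
open import Data.Nat.Induction using (<-wellFounded)
open import Data.Nat.ListAction using (sum)
open import Data.Nat.ListAction.Properties using (sum-++)
open import Data.Nat.Properties
open import Algebra.Properties.CommutativeSemigroup *-commutativeSemigroup
  using (interchange; x∙yz≈y∙xz; x∙yz≈xz∙y; x∙yz≈z∙xy; xy∙z≈y∙xz; xy∙z≈xz∙y)
open import Data.Nat.Tactic.RingSolver using (solve-∀)
open import Data.Product using (_×_; _,_; ∃-syntax)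
open import Data.Sum.Base using (_⊎_; inj₁; inj₂)
open import Data.Unit.Base using (tt)
open import Data.Vec.Base using (Vec; []; _∷_; replicate; here; there)
open import Data.Vec.Relation.Unary.All using (All; []; _∷_)
open import Function.Base using (id; _∘_)
open import Induction.WellFounded using (Acc; acc)
open import Relation.Binary.PropositionalEquality
  using (_≡_; refl; sym; trans; cong; cong₂; subst; module ≡-Reasoning)
open import Relation.Nullary using (yes; no; ¬_; contradiction)
open import Defs

^-distribʳ-* : ∀ m n o → (m * n) ^ o ≡ m ^ o * n ^ o
^-distribʳ-* m n zero    = refl
^-distribʳ-* m n (suc o) = begin
  m * n * (m * n) ^ o      ≡⟨ cong (m * n *_) (^-distribʳ-* m n o) ⟩
  m * n * (m ^ o * n ^ o)  ≡⟨ interchange m n (m ^ o) (n ^ o) ⟩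
  m * m ^ o * (n * n ^ o)  ∎
  where open ≡-Reasoning

[m^n]^o≡[m^o]^n : ∀ m n o → (m ^ n) ^ o ≡ (m ^ o) ^ n
[m^n]^o≡[m^o]^n m n o = begin
  (m ^ n) ^ o  ≡⟨ ^-*-assoc m n o ⟩
  m ^ (n * o)  ≡⟨ cong (m ^_) (*-comm n o) ⟩
  m ^ (o * n)  ≡⟨ ^-*-assoc m o n ⟨
  (m ^ o) ^ n  ∎
  where open ≡-Reasoning

bernoulli : ∀ y u → y ^ u * (y + u) ≤ y * suc y ^ u
bernoulli y zero    = ≤-reflexive (trans (+-identityʳ (y + 0)) (trans (+-identityʳ y) (sym (*-identityʳ y))))
bernoulli y (suc u) = begin
  y * y ^ u * (y + suc u)                ≤⟨ m≤m+n _ (y ^ u * u) ⟩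
  y * y ^ u * (y + suc u) + y ^ u * u    ≡⟨ regroup y (y ^ u) u ⟩
  suc y * (y ^ u * (y + u))              ≤⟨ *-monoʳ-≤ (suc y) (bernoulli y u) ⟩
  suc y * (y * suc y ^ u)                ≡⟨ x∙yz≈y∙xz (suc y) y (suc y ^ u) ⟩
  y * (suc y * suc y ^ u)                ∎
  where
  open ≤-Reasoning
  regroup : ∀ y p u → y * p * (y + suc u) + p * u ≡ suc y * (p * (y + u))
  regroup = solve-∀

^-mean-value : ∀ a i → suc a ^ suc i ≤ a ^ suc i + suc i * suc a ^ i
^-mean-value a zero    = ≤-reflexive (base a)
  where
  base : ∀ a → suc a * 1 ≡ a * 1 + 1 * 1
  base = solve-∀
^-mean-value a (suc i) = begin
  suc a * suc a ^ suc i                                        ≤⟨ *-monoʳ-≤ (suc a) (^-mean-value a i) ⟩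
  suc a * (a ^ suc i + suc i * suc a ^ i)                      ≡⟨ expand (a ^ suc i) (suc a ^ i) a i ⟩
  a * a ^ suc i + (a ^ suc i + suc i * (suc a * suc a ^ i))
    ≤⟨ +-monoʳ-≤ (a * a ^ suc i) (+-monoˡ-≤ _ (^-monoˡ-≤ (suc i) (n≤1+n a))) ⟩
  a * a ^ suc i + (suc a ^ suc i + suc i * suc a ^ suc i)      ≡⟨⟩
  a * a ^ suc i + suc (suc i) * (suc a * suc a ^ i)            ∎
  where
  open ≤-Reasoning
  expand : ∀ x y a i → suc a * (x + suc i * y) ≡ a * x + (x + suc i * (suc a * y))
  expand = solve-∀

[1+c]^b*d≤c^b*c : ∀ {c} b d → b + d ≡ c → suc c ^ b * d ≤ c ^ b * c
[1+c]^b*d≤c^b*c zero    d refl = ≤-refl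
[1+c]^b*d≤c^b*c {c} (suc b) d b+d≡c = begin
  suc c * suc c ^ b * d    ≡⟨ xy∙z≈y∙xz (suc c) (suc c ^ b) d ⟩
  suc c ^ b * (suc c * d)  ≤⟨ *-monoʳ-≤ (suc c ^ b) [1+c]d≤c[1+d] ⟩
  suc c ^ b * (c * suc d)  ≡⟨ x∙yz≈y∙xz (suc c ^ b) c (suc d) ⟩
  c * (suc c ^ b * suc d)  ≤⟨ *-monoʳ-≤ c ([1+c]^b*d≤c^b*c b (suc d) (trans (+-suc b d) b+d≡c)) ⟩
  c * (c ^ b * c)          ≡⟨ *-assoc c (c ^ b) c ⟨
  c * c ^ b * c            ∎
  where
  open ≤-Reasoning
  [1+c]d≤c[1+d] : suc c * d ≤ c * suc d
  [1+c]d≤c[1+d] = begin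
    d + c * d      ≤⟨ +-monoˡ-≤ (c * d) (subst (d ≤_) b+d≡c (m≤n+m d (suc b))) ⟩
    c + c * d      ≡⟨ *-suc c d ⟨
    c * suc d      ∎

[1+mb]^b*g≤[mb]^b*m : ∀ g b → suc (suc g * b) ^ b * g ≤ (suc g * b) ^ b * suc g
[1+mb]^b*g≤[mb]^b*m g zero        = *-monoʳ-≤ 1 (n≤1+n g)
[1+mb]^b*g≤[mb]^b*m g b@(suc _)   = *-cancelʳ-≤ _ _ b (begin
  suc K ^ b * g * b    ≡⟨ *-assoc (suc K ^ b) g b ⟩
  suc K ^ b * (g * b)  ≤⟨ [1+c]^b*d≤c^b*c b (g * b) refl ⟩
  K ^ b * K            ≡⟨ *-assoc (K ^ b) (suc g) b ⟨
  K ^ b * suc g * b    ∎)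
  where
  open ≤-Reasoning
  K = suc g * b

^-archimedean : ∀ {x y c d} .{{_ : NonZero y}} .{{_ : NonZero c}} →
                (∀ u → .{{_ : NonZero u}} → x ^ u * c ≤ y ^ u * d) → x ≤ y
^-archimedean {x} {y} {c} {d} bound = ≮⇒≥ λ y<x → <⇒≱ (*-monoʳ-< (y ^ u) yd<y+u) (begin
  y ^ u * (y + u)  ≤⟨ bernoulli y u ⟩
  y * suc y ^ u    ≤⟨ *-monoʳ-≤ y (^-monoˡ-≤ u y<x) ⟩
  y * x ^ u        ≤⟨ *-monoʳ-≤ y (m≤m*n (x ^ u) c) ⟩
  y * (x ^ u * c)  ≤⟨ *-monoʳ-≤ y (bound u) ⟩
  y * (y ^ u * d)  ≡⟨ x∙yz≈y∙xz y (y ^ u) d ⟩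
  y ^ u * (y * d)  ∎)
  where
  open ≤-Reasoning
  u = suc (y * d)
  instance _ = m^n≢0 y u
  yd<y+u : y * d < y + u
  yd<y+u = <-≤-trans (n<1+n (y * d)) (m≤n+m u y)

-- Read as m ≤ (1+1/K)^E and (1+1/K)^b ≤ m/g, so m^b ≤ (1+1/K)^(bE) ≤ (m/g)^E.
m^b*g^E≤m^E : ∀ {m g K} b E .{{_ : NonZero K}} →
              m * K ^ E ≤ suc K ^ E → suc K ^ b * g ≤ K ^ b * m → m ^ b * g ^ E ≤ m ^ E
m^b*g^E≤m^E {m} {g} {K} b E mK^E≤[1+K]^E [1+K]^b*g≤K^b*m = *-cancelʳ-≤ _ _ ((K ^ E) ^ b) (begin
  m ^ b * g ^ E * (K ^ E) ^ b  ≡⟨ xy∙z≈xz∙y (m ^ b) (g ^ E) ((K ^ E) ^ b) ⟩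
  m ^ b * (K ^ E) ^ b * g ^ E  ≡⟨ cong (_* g ^ E) (^-distribʳ-* m (K ^ E) b) ⟨
  (m * K ^ E) ^ b * g ^ E      ≤⟨ *-monoˡ-≤ (g ^ E) (^-monoˡ-≤ b mK^E≤[1+K]^E) ⟩
  (suc K ^ E) ^ b * g ^ E      ≡⟨ cong (_* g ^ E) ([m^n]^o≡[m^o]^n (suc K) E b) ⟩
  (suc K ^ b) ^ E * g ^ E      ≡⟨ ^-distribʳ-* (suc K ^ b) g E ⟨
  (suc K ^ b * g) ^ E          ≤⟨ ^-monoˡ-≤ E [1+K]^b*g≤K^b*m ⟩
  (K ^ b * m) ^ E              ≡⟨ ^-distribʳ-* (K ^ b) m E ⟩
  (K ^ b) ^ E * m ^ E          ≡⟨ cong (_* m ^ E) ([m^n]^o≡[m^o]^n K b E) ⟩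
  (K ^ E) ^ b * m ^ E          ≡⟨ *-comm ((K ^ E) ^ b) (m ^ E) ⟩
  m ^ E * (K ^ E) ^ b          ∎)
  where
  open ≤-Reasoning
  instance
    _ = m^n≢0 K E
    _ = m^n≢0 (K ^ E) b

nPk≡nP′k : ∀ {n k} → k ≤ n → n P k ≡ n P′ k
nPk≡nP′k {n} {k} k≤n with k ≤ᵇ n in eq
... | true  = refl
... | false = contradiction (≤⇒≤ᵇ k≤n) (subst T eq)

[1+n]P[1+k]≡[1+n]*nPk : ∀ {n k} → k ≤ n → suc n P suc k ≡ suc n * (n P k)
[1+n]P[1+k]≡[1+n]*nPk {n} {k} k≤n = begin
  suc n P suc k     ≡⟨ nPk≡nP′k (s≤s k≤n) ⟩
  suc n P′ suc k    ≡⟨ nP′k≡n[n∸1P′k∸1] (suc n) (suc k) ⟩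
  suc n * (n P′ k)  ≡⟨ cong (suc n *_) (nPk≡nP′k k≤n) ⟨
  suc n * (n P k)   ∎
  where open ≡-Reasoning

sum-applyUpTo-suc : ∀ (f : ℕ → ℕ) n → sum (applyUpTo f (suc n)) ≡ sum (applyUpTo f n) + f n
sum-applyUpTo-suc f n = begin
  sum (applyUpTo f (suc n))            ≡⟨ cong sum (applyUpTo-∷ʳ f n) ⟨
  sum (applyUpTo f n ++ [ f n ])       ≡⟨ sum-++ (applyUpTo f n) [ f n ] ⟩
  sum (applyUpTo f n) + (f n + 0)      ≡⟨ cong (sum (applyUpTo f n) +_) (+-identityʳ (f n)) ⟩
  sum (applyUpTo f n) + f n            ∎
  where open ≡-Reasoning

sum-applyUpTo-* : ∀ c (f g : ℕ → ℕ) n → (∀ {i} → i < n → f i ≡ c * g i) →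
                  sum (applyUpTo f n) ≡ c * sum (applyUpTo g n)
sum-applyUpTo-* c f g zero    f≡cg = sym (*-zeroʳ c)
sum-applyUpTo-* c f g (suc n) f≡cg = begin
  f 0 + sum (applyUpTo (f ∘ suc) n)
    ≡⟨ cong₂ _+_ (f≡cg z<s) (sum-applyUpTo-* c (f ∘ suc) (g ∘ suc) n (f≡cg ∘ s<s)) ⟩
  c * g 0 + c * sum (applyUpTo (g ∘ suc) n) ≡⟨ *-distribˡ-+ c (g 0) _ ⟨
  c * (g 0 + sum (applyUpTo (g ∘ suc) n))   ∎
  where open ≡-Reasoning

-- expPartial K n a = n! K^n Σ_{i ≤ n} (a/K)^i / i!, a partial sum of the series of exp(a/K).
expPartial : ℕ → ℕ → ℕ → ℕ
expPartial K zero    a = 1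
expPartial K (suc n) a = suc n * K * expPartial K n a + a ^ suc n

expTerm : ℕ → ℕ → ℕ → ℕ → ℕ
expTerm K a n i = a ^ i * K ^ (n ∸ i) * (n P (n ∸ i))

expTerm-suc : ∀ K a {n i} → i ≤ n → expTerm K a (suc n) i ≡ suc n * K * expTerm K a n i
expTerm-suc K a {n} {i} i≤n = begin
  a ^ i * K ^ (suc n ∸ i) * (suc n P (suc n ∸ i))
    ≡⟨ cong (λ j → a ^ i * K ^ j * (suc n P j)) (+-∸-assoc 1 i≤n) ⟩
  a ^ i * (K * K ^ (n ∸ i)) * (suc n P suc (n ∸ i))
    ≡⟨ cong (a ^ i * (K * K ^ (n ∸ i)) *_) ([1+n]P[1+k]≡[1+n]*nPk (m∸n≤m n i)) ⟩
  a ^ i * (K * K ^ (n ∸ i)) * (suc n * (n P (n ∸ i)))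
    ≡⟨ regroup (a ^ i) K (K ^ (n ∸ i)) (suc n) (n P (n ∸ i)) ⟩
  suc n * K * (a ^ i * K ^ (n ∸ i) * (n P (n ∸ i)))
    ∎
  where
  open ≡-Reasoning
  regroup : ∀ x K y z w → x * (K * y) * (z * w) ≡ z * K * (x * y * w)
  regroup = solve-∀

expTerm-diagonal : ∀ K a n → expTerm K a n n ≡ a ^ n
expTerm-diagonal K a n rewrite n∸n≡0 n = trans (*-identityʳ _) (*-identityʳ _)

expPartial-sum : ∀ K a n → sum (map (expTerm K a n) (upTo (suc n))) ≡ expPartial K n a
expPartial-sum K a n = trans (cong sum (map-applyUpTo id (expTerm K a n) (suc n))) (sum-expTerm n)
  where
  open ≡-Reasoning
  sum-expTerm : ∀ n → sum (applyUpTo (expTerm K a n) (suc n)) ≡ expPartial K n a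
  sum-expTerm zero    = refl
  sum-expTerm (suc n) = begin
    sum (applyUpTo (expTerm K a (suc n)) (suc (suc n)))
      ≡⟨ sum-applyUpTo-suc (expTerm K a (suc n)) (suc n) ⟩
    sum (applyUpTo (expTerm K a (suc n)) (suc n)) + expTerm K a (suc n) (suc n)
      ≡⟨ cong₂ _+_ (sum-applyUpTo-* (suc n * K) _ _ (suc n) (expTerm-suc K a ∘ ≤-pred))
                   (expTerm-diagonal K a (suc n)) ⟩
    suc n * K * sum (applyUpTo (expTerm K a n) (suc n)) + a ^ suc n
      ≡⟨ cong (λ e → suc n * K * e + a ^ suc n) (sum-expTerm n) ⟩
    suc n * K * expPartial K n a + a ^ suc n
      ∎

expPartial-* : ∀ K u n a → expPartial (K * u) n (a * u) ≡ u ^ n * expPartial K n a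
expPartial-* K u zero    a = refl
expPartial-* K u (suc n) a = begin
  suc n * (K * u) * expPartial (K * u) n (a * u) + a * u * (a * u) ^ n
    ≡⟨ cong₂ (λ x y → suc n * (K * u) * x + a * u * y) (expPartial-* K u n a) (^-distribʳ-* a u n) ⟩
  suc n * (K * u) * (u ^ n * expPartial K n a) + a * u * (a ^ n * u ^ n)
    ≡⟨ factor n K u a (expPartial K n a) (u ^ n) (a ^ n) ⟩
  u * u ^ n * (suc n * K * expPartial K n a + a * a ^ n)
    ∎
  where
  open ≡-Reasoning
  factor : ∀ n K u a e v w → suc n * (K * u) * (v * e) + a * u * (w * v) ≡ u * v * (suc n * K * e + a * w)
  factor = solve-∀

expPartial-zero : ∀ K n → expPartial K n 0 ≡ n ! * K ^ n
expPartial-zero K zero    = refl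
expPartial-zero K (suc n) = begin
  suc n * K * expPartial K n 0 + 0  ≡⟨ cong (λ e → suc n * K * e + 0) (expPartial-zero K n) ⟩
  suc n * K * (n ! * K ^ n) + 0     ≡⟨ regroup K n (n !) (K ^ n) ⟩
  (suc n * n !) * (K * K ^ n)       ∎
  where
  open ≡-Reasoning
  regroup : ∀ K n f p → suc n * K * (f * p) + 0 ≡ (suc n * f) * (K * p)
  regroup = solve-∀

expPartial-suc : ∀ K n a →
                 expPartial K (suc n) (suc a) ≤ expPartial K (suc n) a + suc n * expPartial K n (suc a)
expPartial-suc K zero    a = ≤-reflexive (regroup K a)
  where
  regroup : ∀ K a → 1 * K * 1 + suc a * 1 ≡ 1 * K * 1 + a * 1 + 1 * 1
  regroup = solve-∀
expPartial-suc K (suc n) a = begin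
  suc (suc n) * K * expPartial K (suc n) (suc a) + suc a ^ suc (suc n)
    ≤⟨ +-mono-≤ (*-monoʳ-≤ (suc (suc n) * K) (expPartial-suc K n a)) (^-mean-value a (suc n)) ⟩
  suc (suc n) * K * (x + suc n * y) + (a ^ suc (suc n) + suc (suc n) * suc a ^ suc n)
    ≡⟨ regroup K n x y (a ^ suc (suc n)) (suc a ^ suc n) ⟩
  (suc (suc n) * K * x + a ^ suc (suc n)) + suc (suc n) * (suc n * K * y + suc a ^ suc n)
    ∎
  where
  open ≤-Reasoning
  x = expPartial K (suc n) a
  y = expPartial K n (suc a)
  regroup : ∀ K n x y z w → suc (suc n) * K * (x + suc n * y) + (z + suc (suc n) * w)
                          ≡ (suc (suc n) * K * x + z) + suc (suc n) * (suc n * K * y + w)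
  regroup = solve-∀

expPartial-bound : ∀ K n a → expPartial K n a * K ^ (a + n) ≤ n ! * K ^ n * suc K ^ (a + n)
expPartial-bound K zero    a = *-monoʳ-≤ 1 (^-monoˡ-≤ (a + 0) (n≤1+n K))
expPartial-bound K (suc n) zero = begin
  expPartial K (suc n) 0 * K ^ suc n    ≡⟨ cong (_* K ^ suc n) (expPartial-zero K (suc n)) ⟩
  suc n ! * K ^ suc n * K ^ suc n       ≤⟨ *-monoʳ-≤ (suc n ! * K ^ suc n) (^-monoˡ-≤ (suc n) (n≤1+n K)) ⟩
  suc n ! * K ^ suc n * suc K ^ suc n   ∎
  where open ≤-Reasoning
expPartial-bound K (suc n) (suc a) = begin
  expPartial K (suc n) (suc a) * (K * K ^ E)
    ≤⟨ *-monoˡ-≤ (K * K ^ E) (expPartial-suc K n a) ⟩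
  (expPartial K (suc n) a + suc n * expPartial K n (suc a)) * (K * K ^ E)
    ≡⟨ distribute (expPartial K (suc n) a) (expPartial K n (suc a)) (K ^ E) K n ⟩
  expPartial K (suc n) a * K ^ E * K + suc n * K * (expPartial K n (suc a) * K ^ E)
    ≡⟨ cong (λ e → expPartial K (suc n) a * K ^ E * K + suc n * K * (expPartial K n (suc a) * K ^ e)) (+-suc a n) ⟩
  expPartial K (suc n) a * K ^ E * K + suc n * K * (expPartial K n (suc a) * K ^ (suc a + n))
    ≤⟨ +-mono-≤ (*-monoˡ-≤ K (expPartial-bound K (suc n) a))
                (*-monoʳ-≤ (suc n * K) (expPartial-bound K n (suc a))) ⟩
  suc n ! * K ^ suc n * suc K ^ E * K + suc n * K * (n ! * K ^ n * suc K ^ (suc a + n))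
    ≡⟨ cong (λ e → suc n ! * K ^ suc n * suc K ^ E * K + suc n * K * (n ! * K ^ n * suc K ^ e)) (+-suc a n) ⟨
  suc n ! * K ^ suc n * suc K ^ E * K + suc n * K * (n ! * K ^ n * suc K ^ E)
    ≡⟨ collect (n !) (K ^ n) (suc K ^ E) K n ⟩
  suc n ! * K ^ suc n * (suc K * suc K ^ E)
    ∎
  where
  open ≤-Reasoning
  E = a + suc n
  distribute : ∀ x y p K n → (x + suc n * y) * (K * p) ≡ x * p * K + suc n * K * (y * p)
  distribute = solve-∀
  collect : ∀ f p r K n → (suc n * f) * (K * p) * r * K + suc n * K * (f * p * r)
                        ≡ (suc n * f) * (K * p) * (suc K * r)
  collect = solve-∀

expPartial≥⇒ : ∀ {m K n a} .{{_ : NonZero K}} →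
               m * n ! * K ^ n ≤ expPartial K n a → m * K ^ (a + n) ≤ suc K ^ (a + n)
expPartial≥⇒ {m} {K} {n} {a} m*n!*K^n≤expPartial = *-cancelʳ-≤ _ _ (n ! * K ^ n) (begin
  m * K ^ (a + n) * (n ! * K ^ n)  ≡⟨ regroup m (K ^ (a + n)) (n !) (K ^ n) ⟩
  m * n ! * K ^ n * K ^ (a + n)    ≤⟨ *-monoˡ-≤ (K ^ (a + n)) m*n!*K^n≤expPartial ⟩
  expPartial K n a * K ^ (a + n)   ≤⟨ expPartial-bound K n a ⟩
  n ! * K ^ n * suc K ^ (a + n)    ≡⟨ *-comm (n ! * K ^ n) (suc K ^ (a + n)) ⟩
  suc K ^ (a + n) * (n ! * K ^ n)  ∎)
  where
  open ≤-Reasoning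
  instance
    _ = n !≢0
    _ = m^n≢0 K n
    _ = m*n≢0 (n !) (K ^ n)
  regroup : ∀ x y z w → x * y * (z * w) ≡ x * z * w * y
  regroup = solve-∀

-- Scaling p and q by u gives m^(qu) g^(pu+n) ≤ m^(pu+n); the fixed error n disappears as u grows.
ExpExceeds⇒[1+g]^q*g^p≤[1+g]^p : ∀ {g} p q .{{_ : NonZero g}} .{{_ : NonZero q}} →
                                  ExpExceeds (suc g) p q → suc g ^ q * g ^ p ≤ suc g ^ p
ExpExceeds⇒[1+g]^q*g^p≤[1+g]^p {g} p q (n , exceeds) = ^-archimedean {c = g ^ n} {d = m ^ n} bound
  where
  m = suc g
  instance
    _ = m^n≢0 m p
    _ = m^n≢0 g n
  m*n!*K^n≤expPartial : m * n ! * (m * q) ^ n ≤ expPartial (m * q) n p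
  m*n!*K^n≤expPartial = subst (m * n ! * (m * q) ^ n ≤_) (expPartial-sum (m * q) p n) (<⇒≤ exceeds)
  bound : ∀ u .{{_ : NonZero u}} → (m ^ q * g ^ p) ^ u * g ^ n ≤ (m ^ p) ^ u * m ^ n
  bound u = begin
    (m ^ q * g ^ p) ^ u * g ^ n          ≡⟨ cong (_* g ^ n) (^-distribʳ-* (m ^ q) (g ^ p) u) ⟩
    (m ^ q) ^ u * (g ^ p) ^ u * g ^ n    ≡⟨ cong₂ (λ x y → x * y * g ^ n) (^-*-assoc m q u) (^-*-assoc g p u) ⟩
    m ^ b * g ^ (p * u) * g ^ n          ≡⟨ *-assoc (m ^ b) (g ^ (p * u)) (g ^ n) ⟩
    m ^ b * (g ^ (p * u) * g ^ n)        ≡⟨ cong (m ^ b *_) (^-distribˡ-+-* g (p * u) n) ⟨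
    m ^ b * g ^ (p * u + n)              ≤⟨ m^b*g^E≤m^E b (p * u + n) (expPartial≥⇒ {m} {m * b} {n} {p * u} scaled)
                                                           ([1+mb]^b*g≤[mb]^b*m g b) ⟩
    m ^ (p * u + n)                      ≡⟨ ^-distribˡ-+-* m (p * u) n ⟩
    m ^ (p * u) * m ^ n                  ≡⟨ cong (_* m ^ n) (^-*-assoc m p u) ⟨
    (m ^ p) ^ u * m ^ n                  ∎
    where
    open ≤-Reasoning
    b = q * u
    instance
      _ = m*n≢0 q u
      _ = m*n≢0 m b
    scaled : m * n ! * (m * b) ^ n ≤ expPartial (m * b) n (p * u)
    scaled = begin
      m * n ! * (m * b) ^ n              ≡⟨ cong (λ K → m * n ! * K ^ n) (*-assoc m q u) ⟨
      m * n ! * (m * q * u) ^ n          ≡⟨ cong (m * n ! *_) (^-distribʳ-* (m * q) u n) ⟩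
      m * n ! * ((m * q) ^ n * u ^ n)    ≡⟨ regroup (m * n !) ((m * q) ^ n) (u ^ n) ⟩
      u ^ n * (m * n ! * (m * q) ^ n)    ≤⟨ *-monoʳ-≤ (u ^ n) m*n!*K^n≤expPartial ⟩
      u ^ n * expPartial (m * q) n p     ≡⟨ expPartial-* (m * q) u n p ⟨
      expPartial (m * q * u) n (p * u)   ≡⟨ cong (λ K → expPartial K n (p * u)) (*-assoc m q u) ⟩
      expPartial (m * b) n (p * u)       ∎
      where
      regroup : ∀ x y z → x * (y * z) ≡ z * (x * y)
      regroup = solve-∀

indicator : ∀ {N} → Subset N → ℕ → ℕ
indicator []      _       = 0
indicator (x ∷ _) zero    = if x then 1 else 0
indicator (_ ∷ A) (suc a) = indicator A a

indicator-∈ : ∀ {N} (A : Subset N) a .(a<N : a < N) → fromℕ< a<N ∈ A → indicator A a ≡ 1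
indicator-∈ (_ ∷ _) zero    _   here        = refl
indicator-∈ (_ ∷ A) (suc a) a<N (there a∈A) = indicator-∈ A a (s<s⁻¹ a<N) a∈A

indicator-∉ : ∀ {N} (A : Subset N) a .(a<N : a < N) → ¬ (fromℕ< a<N ∈ A) → indicator A a ≡ 0
indicator-∉ (true ∷ _)  zero    _   a∉A = contradiction here a∉A
indicator-∉ (false ∷ _) zero    _   a∉A = refl
indicator-∉ (_ ∷ A)     (suc a) a<N a∉A = indicator-∉ A a (s<s⁻¹ a<N) (a∉A ∘ there)

indicator-≥ : ∀ {N} (A : Subset N) a → ¬ (a < N) → indicator A a ≡ 0
indicator-≥ []      a       _   = refl
indicator-≥ (_ ∷ _) zero    a≮N = contradiction z<s a≮N
indicator-≥ (_ ∷ A) (suc a) a≮N = indicator-≥ A a (a≮N ∘ s<s)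

indicator≤1 : ∀ {N} (A : Subset N) a → indicator A a ≤ 1
indicator≤1 []          _       = z≤n
indicator≤1 (true ∷ _)  zero    = ≤-refl
indicator≤1 (false ∷ _) zero    = z≤n
indicator≤1 (_ ∷ A)     (suc a) = indicator≤1 A a

cnt-suc : ∀ {N} (A : Subset N) a L → cnt A a (suc L) ≡ indicator A a + cnt A (suc a) L
cnt-suc {N} A a L with a <? N
... | no a≮N = cong (_+ cnt A (suc a) L) (sym (indicator-≥ A a a≮N))
... | yes a<N with fromℕ< a<N ∈? A
...   | yes a∈A = cong (_+ cnt A (suc a) L) (sym (indicator-∈ A a a<N a∈A))
...   | no  a∉A = cong (_+ cnt A (suc a) L) (sym (indicator-∉ A a a<N a∉A))

cnt≤ : ∀ {N} (A : Subset N) a L → cnt A a L ≤ L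
cnt≤ A a zero    = z≤n
cnt≤ A a (suc L) rewrite cnt-suc A a L = +-mono-≤ (indicator≤1 A a) (cnt≤ A (suc a) L)

cnt-+ : ∀ {N} (A : Subset N) a l L → cnt A a (l + L) ≡ cnt A a l + cnt A (a + l) L
cnt-+ A a zero    L rewrite +-identityʳ a = refl
cnt-+ A a (suc l) L rewrite cnt-suc A a (l + L) | cnt-suc A a l | cnt-+ A (suc a) l L | +-suc a l =
  sym (+-assoc (indicator A a) _ _)

cnt-∷ : ∀ {N} x (A : Subset N) a L → cnt (x ∷ A) (suc a) L ≡ cnt A a L
cnt-∷ x A a zero    = refl
cnt-∷ x A a (suc L) rewrite cnt-suc (x ∷ A) (suc a) L | cnt-suc A a L | cnt-∷ x A (suc a) L = refl

cnt-whole : ∀ {N} (A : Subset N) → cnt A 0 N ≡ ∣ A ∣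
cnt-whole []                = refl
cnt-whole {suc N} (x ∷ A) rewrite cnt-suc (x ∷ A) 0 N | cnt-∷ x A 0 N | cnt-whole A with x
... | true  = refl
... | false = refl

Dense : ∀ {N} → Subset N → (u v b l : ℕ) → Set
Dense A u v b l = u * l ≤ v * cnt A b l

SparseBy : ∀ {N} → Subset N → (d u v b l : ℕ) → Set
SparseBy A d u v b l = v * cnt A b l + d ≤ u * l

sparseBy-+ : ∀ {N} {A : Subset N} {d e u v b l L} →
             SparseBy A d u v b l → SparseBy A e u v (b + l) L → SparseBy A (d + e) u v b (l + L)
sparseBy-+ {A = A} {d} {e} {u} {v} {b} {l} {L} sparseˡ sparseʳ = begin
  v * cnt A b (l + L) + (d + e)                  ≡⟨ cong (λ c → v * c + (d + e)) (cnt-+ A b l L) ⟩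
  v * (cnt A b l + cnt A (b + l) L) + (d + e)    ≡⟨ regroup v (cnt A b l) (cnt A (b + l) L) d e ⟩
  (v * cnt A b l + d) + (v * cnt A (b + l) L + e) ≤⟨ +-mono-≤ sparseˡ sparseʳ ⟩
  u * l + u * L                                  ≡⟨ *-distribˡ-+ u l L ⟨
  u * (l + L)                                    ∎
  where
  open ≤-Reasoning
  regroup : ∀ v x y d e → v * (x + y) + (d + e) ≡ (v * x + d) + (v * y + e)
  regroup = solve-∀

equidistributed : ∀ {N} {A : Subset N} {k} .{{_ : NonZero k}} {a L} (ls : Vec ℕ k) →
                  vsum ls ≡ L → Good A (L / k) a ls → Equidistributed A k a L
equidistributed {k = suc _} ls vsum≡L good = ls , vsum≡L , good

vsum-replicate : ∀ n x → vsum (replicate n x) ≡ n * x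
vsum-replicate zero    x = refl
vsum-replicate (suc n) x = cong (x +_) (vsum-replicate n x)

short⇒equidistributed : ∀ {N} (A : Subset N) k .{{_ : NonZero k}} {a L} → L < k →
                        ∣ A ∣ * L ≤ 2 * N * cnt A a L → Equidistributed A k a L
short⇒equidistributed {N} A (suc k) {a} {L} L<k half =
  equidistributed (L ∷ replicate k 0) (trans (cong (L +_) (trans (vsum-replicate k 0) (*-zeroʳ k))) (+-identityʳ L))
    (subst (λ s → Good A s a (L ∷ replicate k 0)) (sym (m<n⇒m/n≡0 L<k)) (z≤n , half , emptyPieces k (a + L)))
  where
  emptyPieces : ∀ n b → Good A 0 b (replicate n 0)
  emptyPieces zero    b = tt
  emptyPieces (suc n) b = z≤n , ≤-reflexive (trans (*-zeroʳ ∣ A ∣) (sym (*-zeroʳ (2 * N)))) , emptyPieces n (b + 0)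

n≤m⇒m<2*[m/n]*n : ∀ m n .{{_ : NonZero n}} → n ≤ m → m < 2 * (m / n) * n
n≤m⇒m<2*[m/n]*n m n n≤m = begin-strict
  m                        ≡⟨ m≡m%n+[m/n]*n m n ⟩
  m % n + m / n * n        <⟨ +-monoˡ-< (m / n * n) (m%n<n m n) ⟩
  n + m / n * n            ≤⟨ +-monoˡ-≤ (m / n * n) (m≤n*m n (m / n) {{>-nonZero (m≥n⇒m/n>0 n≤m)}}) ⟩
  m / n * n + m / n * n    ≡⟨ double (m / n) n ⟩
  2 * (m / n) * n          ∎
  where
  open ≤-Reasoning
  double : ∀ x y → x * y + x * y ≡ 2 * x * y
  double = solve-∀

evenSplit : ∀ k .{{_ : NonZero k}} → ℕ → Vec ℕ k
evenSplit (suc k) L = L ∸ k * (L / suc k) ∷ replicate k (L / suc k)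

vsum-evenSplit : ∀ k .{{_ : NonZero k}} L → vsum (evenSplit k L) ≡ L
vsum-evenSplit (suc k) L = begin
  L ∸ k * s + vsum (replicate k s)  ≡⟨ cong (L ∸ k * s +_) (vsum-replicate k s) ⟩
  L ∸ k * s + k * s                 ≡⟨ m∸n+n≡m ks≤L ⟩
  L                                 ∎
  where
  open ≡-Reasoning
  s = L / suc k
  ks≤L : k * s ≤ L
  ks≤L = ≤-trans (m≤n+m (k * s) s) (≤-trans (≤-reflexive (*-comm (suc k) s)) (m/n*n≤m L (suc k)))

evenSplit-pieces : ∀ k .{{_ : NonZero k}} {L} → 2 ≤ k → k ≤ L →
                   All (λ l → L / k ≤ l × l < L) (evenSplit k L)
evenSplit-pieces (suc k) {L} (s≤s 1≤k) k≤L = (s≤L∸ks , L∸ks<L) ∷ pieces k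
  where
  s = L / suc k
  instance _ = >-nonZero (m≥n⇒m/n>0 k≤L)
  s+ks≤L : s + k * s ≤ L
  s+ks≤L = ≤-trans (≤-reflexive (*-comm (suc k) s)) (m/n*n≤m L (suc k))
  0<ks : 0 < k * s
  0<ks = >-nonZero⁻¹ (k * s) {{m*n≢0 k s {{>-nonZero 1≤k}}}}
  s≤L∸ks : s ≤ L ∸ k * s
  s≤L∸ks = +-cancelʳ-≤ (k * s) s (L ∸ k * s)
             (≤-trans s+ks≤L (≤-reflexive (sym (m∸n+n≡m (≤-trans (m≤n+m (k * s) s) s+ks≤L)))))
  L∸ks<L : L ∸ k * s < L
  L∸ks<L = ∸-monoʳ-< 0<ks (≤-trans (m≤n+m (k * s) s) s+ks≤L)
  pieces : ∀ n → All (λ l → s ≤ l × l < L) (replicate n s)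
  pieces zero    = []
  pieces (suc n) = (≤-refl , <-≤-trans (m<m+n s 0<ks) s+ks≤L) ∷ pieces n

module DensityIncrement {N} (A : Subset N) .{{_ : NonZero ∣ A ∣}}
                        (k g : ℕ) .{{_ : NonZero k}} (2≤k : 2 ≤ k) (4k≤1+g : 4 * k ≤ suc g) where

  m : ℕ
  m = suc g

  DenseAt : ℕ → ℕ → ℕ → Set
  DenseAt j = Dense A (∣ A ∣ * m ^ j) (N * g ^ j)

  -- Both weights are doubled so that a piece of density below δ/2 leaves an integral slack.
  SparseAt : ℕ → ℕ → ℕ → ℕ → Set
  SparseAt j d = SparseBy A d (2 * (∣ A ∣ * m ^ j)) (2 * (N * g ^ j))

  sparseAt-+ : ∀ {j d e b l L} → SparseAt j d b l → SparseAt j e (b + l) L → SparseAt j (d + e) b (l + L)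
  sparseAt-+ {j} = sparseBy-+ {A = A} {u = 2 * (∣ A ∣ * m ^ j)} {v = 2 * (N * g ^ j)}

  ¬dense⇒sparse : ∀ {j b l} → ¬ DenseAt j b l → SparseAt j 0 b l
  ¬dense⇒sparse {j} {b} {l} ¬dense = begin
    2 * (N * g ^ j) * cnt A b l + 0  ≡⟨ +-identityʳ _ ⟩
    2 * (N * g ^ j) * cnt A b l      ≡⟨ *-assoc 2 (N * g ^ j) (cnt A b l) ⟩
    2 * (N * g ^ j * cnt A b l)      ≤⟨ *-monoʳ-≤ 2 (<⇒≤ (≰⇒> ¬dense)) ⟩
    2 * (∣ A ∣ * m ^ j * l)          ≡⟨ *-assoc 2 (∣ A ∣ * m ^ j) l ⟨
    2 * (∣ A ∣ * m ^ j) * l          ∎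
    where open ≤-Reasoning

  ¬halfDense⇒sparse : ∀ {j b l} → ¬ (∣ A ∣ * l ≤ 2 * N * cnt A b l) → SparseAt j (∣ A ∣ * m ^ j * l) b l
  ¬halfDense⇒sparse {j} {b} {l} ¬halfDense = begin
    2 * (N * g ^ j) * cnt A b l + ∣ A ∣ * m ^ j * l
      ≡⟨ cong (_+ ∣ A ∣ * m ^ j * l) (regroup N (g ^ j) (cnt A b l)) ⟩
    2 * N * cnt A b l * g ^ j + ∣ A ∣ * m ^ j * l
      ≤⟨ +-monoˡ-≤ _ (*-mono-≤ (<⇒≤ (≰⇒> ¬halfDense)) (^-monoˡ-≤ j (n≤1+n g))) ⟩
    ∣ A ∣ * l * m ^ j + ∣ A ∣ * m ^ j * l
      ≡⟨ double ∣ A ∣ l (m ^ j) ⟩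
    2 * (∣ A ∣ * m ^ j) * l
      ∎
    where
    open ≤-Reasoning
    regroup : ∀ n p c → 2 * (n * p) * c ≡ 2 * n * c * p
    regroup = solve-∀
    double : ∀ a l p → a * l * p + a * p * l ≡ 2 * (a * p) * l
    double = solve-∀

  -- The whole holds at least θ (L - L/m) points of A for θ = δ (m/g)^(j+1). With every piece below θ,
  -- a piece of length l below δ/2 ≤ θ/2 costs at least θ l/2 of them, so l/2 ≤ L/m.
  dense-sparse⇒short : ∀ {j a L l} → DenseAt j a L → SparseAt (suc j) (∣ A ∣ * m ^ suc j * l) a L →
                       m * l ≤ 2 * L
  dense-sparse⇒short {j} {a} {L} {l} dense sparse =
    +-cancelʳ-≤ (2 * g * L) (m * l) (2 * L) (*-cancelʳ-≤ _ _ (∣ A ∣ * m ^ j) (begin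
      (m * l + 2 * g * L) * (∣ A ∣ * m ^ j)             ≡⟨ lhs ∣ A ∣ (m ^ j) g l L ⟩
      ∣ A ∣ * m ^ j * m * l + 2 * g * (∣ A ∣ * m ^ j * L) ≤⟨ +-monoʳ-≤ _ (*-monoʳ-≤ (2 * g) dense) ⟩
      ∣ A ∣ * m ^ j * m * l + 2 * g * (N * g ^ j * c)   ≡⟨ middle ∣ A ∣ (m ^ j) g l N (g ^ j) c ⟩
      2 * (N * (g * g ^ j)) * c + ∣ A ∣ * (m * m ^ j) * l ≤⟨ sparse ⟩
      2 * (∣ A ∣ * (m * m ^ j)) * L                     ≡⟨ rhs ∣ A ∣ (m ^ j) g L ⟩
      (2 * L + 2 * g * L) * (∣ A ∣ * m ^ j)             ∎))
    where
    open ≤-Reasoning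
    c = cnt A a L
    instance
      _ = m^n≢0 m j
      _ = m*n≢0 ∣ A ∣ (m ^ j)
    lhs : ∀ a p g l L → (suc g * l + 2 * g * L) * (a * p) ≡ a * p * suc g * l + 2 * g * (a * p * L)
    lhs = solve-∀
    middle : ∀ a p g l n q c → a * p * suc g * l + 2 * g * (n * q * c) ≡ 2 * (n * (g * q)) * c + a * (suc g * p) * l
    middle = solve-∀
    rhs : ∀ a p g L → 2 * (a * (suc g * p)) * L ≡ (2 * L + 2 * g * L) * (a * p)
    rhs = solve-∀

  data Scan (j s U b : ℕ) {n} (ls : Vec ℕ n) : Set where
    densePiece  : ∀ {c l} → c + l ≤ b + vsum ls → s ≤ l → l < U → DenseAt (suc j) c l → Scan j s U b ls
    halfDense   : Good A s b ls → SparseAt (suc j) 0 b (vsum ls) → Scan j s U b ls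
    sparsePiece : ∀ {l} → s ≤ l → SparseAt (suc j) (∣ A ∣ * m ^ suc j * l) b (vsum ls) → Scan j s U b ls

  scan : ∀ j {s U} b {n} (ls : Vec ℕ n) → All (λ l → s ≤ l × l < U) ls → Scan j s U b ls
  scan j b []       []  = halfDense tt (≤-reflexive (trans (+-identityʳ _)
    (trans (*-zeroʳ (2 * (N * g ^ suc j))) (sym (*-zeroʳ (2 * (∣ A ∣ * m ^ suc j)))))))
  scan j {s} {U} b (l ∷ ls) ((s≤l , l<U) ∷ pieces)
    with ∣ A ∣ * m ^ suc j * l ≤? N * g ^ suc j * cnt A b l
  ... | yes dense = densePiece (+-monoʳ-≤ b (m≤m+n l (vsum ls))) s≤l l<U dense
  ... | no ¬dense = extend (scan j (b + l) ls pieces)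
    where
    extend : Scan j s U (b + l) ls → Scan j s U b (l ∷ ls)
    extend (densePiece c+l′≤ s≤l′ l′<U dense) =
      densePiece (≤-trans c+l′≤ (≤-reflexive (+-assoc b l (vsum ls)))) s≤l′ l′<U dense
    extend (sparsePiece s≤l′ sparse) =
      sparsePiece s≤l′ (sparseAt-+ {suc j} (¬dense⇒sparse {suc j} ¬dense) sparse)
    extend (halfDense good sparse) with ∣ A ∣ * l ≤? 2 * N * cnt A b l
    ... | yes half = halfDense (s≤l , half , good) (sparseAt-+ {suc j} (¬dense⇒sparse {suc j} ¬dense) sparse)
    ... | no ¬half = sparsePiece s≤l (subst (λ d → SparseAt (suc j) d b (l + vsum ls)) (+-identityʳ _)
                                        (sparseAt-+ {suc j} (¬halfDense⇒sparse {suc j} ¬half) sparse))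

  2L<m*l : ∀ {L l} → k ≤ L → L / k ≤ l → 2 * L < m * l
  2L<m*l {L} {l} k≤L L/k≤l = begin-strict
    2 * L                    <⟨ *-monoʳ-< 2 (n≤m⇒m<2*[m/n]*n L k k≤L) ⟩
    2 * (2 * (L / k) * k)    ≡⟨ regroup (L / k) k ⟩
    L / k * (4 * k)          ≤⟨ *-mono-≤ L/k≤l 4k≤1+g ⟩
    l * m                    ≡⟨ *-comm l m ⟩
    m * l                    ∎
    where
    open ≤-Reasoning
    regroup : ∀ s k → 2 * (2 * s * k) ≡ s * (4 * k)
    regroup = solve-∀

  increment : ∀ {j a L} → k ≤ L → DenseAt j a L →
              Equidistributed A k a L ⊎
              ∃[ b ] ∃[ l ] (b + l ≤ a + L × l < L × L ≤ m * l × DenseAt (suc j) b l)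
  increment {j} {a} {L} k≤L dense with scan j a (evenSplit k L) (evenSplit-pieces k 2≤k k≤L)
  ... | densePiece b+l≤ L/k≤l l<L dense⁺ =
    inj₂ (_ , _ , subst (λ T → _ ≤ a + T) (vsum-evenSplit k L) b+l≤ , l<L ,
          ≤-trans (m≤n*m L 2) (<⇒≤ (2L<m*l k≤L L/k≤l)) , dense⁺)
  ... | halfDense good _ = inj₁ (equidistributed (evenSplit k L) (vsum-evenSplit k L) good)
  ... | sparsePiece L/k≤l sparse =
    contradiction (dense-sparse⇒short {j} dense (subst (SparseAt (suc j) _ a) (vsum-evenSplit k L) sparse))
                  (<⇒≱ (2L<m*l k≤L L/k≤l))

  denseAt⇒halfDense : ∀ {j a L} → DenseAt j a L → ∣ A ∣ * L ≤ 2 * N * cnt A a L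
  denseAt⇒halfDense {j} {a} {L} dense = ≤-trans (*-cancelʳ-≤ _ _ (m ^ j) (begin
    ∣ A ∣ * L * m ^ j  ≡⟨ xy∙z≈xz∙y ∣ A ∣ L (m ^ j) ⟩
    ∣ A ∣ * m ^ j * L  ≤⟨ dense ⟩
    N * g ^ j * c      ≤⟨ *-monoˡ-≤ c (*-monoʳ-≤ N (^-monoˡ-≤ j (n≤1+n g))) ⟩
    N * m ^ j * c      ≡⟨ xy∙z≈xz∙y N (m ^ j) c ⟩
    N * c * m ^ j      ∎)) (*-monoˡ-≤ c (m≤n*m N 2))
    where
    open ≤-Reasoning
    c = cnt A a L
    instance _ = m^n≢0 m j

  denseAt⇒density-bound : ∀ {j a L} → DenseAt j a L → N ≤ m ^ j * L → ∣ A ∣ * m ^ j ≤ N * g ^ j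
  denseAt⇒density-bound {j} {a} {zero} _ long =
    contradiction (≤-trans (subst (_≤ N) (cnt-whole A) (cnt≤ A 0 N))
                           (≤-trans long (≤-reflexive (*-zeroʳ (m ^ j)))))
                  (<⇒≱ (>-nonZero⁻¹ ∣ A ∣))
  denseAt⇒density-bound {j} {a} {L@(suc _)} dense _ =
    *-cancelʳ-≤ _ _ L (≤-trans dense (*-monoʳ-≤ (N * g ^ j) (cnt≤ A a L)))

  Candidate : Set
  Candidate = ∃[ a ] ∃[ L ] ∃[ j ] (a + L ≤ N × Equidistributed A k a L × DenseAt j a L × N ≤ m ^ j * L)

  iterate : ∀ {a L j} → Acc _<_ L → a + L ≤ N → DenseAt j a L → N ≤ m ^ j * L → Candidate
  iterate {a} {L} {j} (acc rec) a+L≤N dense long with L <? k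
  ... | yes L<k = a , L , j , a+L≤N , short⇒equidistributed A k L<k (denseAt⇒halfDense {j} dense) , dense , long
  ... | no  L≮k with increment {j} (≮⇒≥ L≮k) dense
  ...   | inj₁ equidistributedAL = a , L , j , a+L≤N , equidistributedAL , dense , long
  ...   | inj₂ (b , l , b+l≤a+L , l<L , L≤ml , dense⁺) =
    iterate {j = suc j} (rec l<L) (≤-trans b+l≤a+L a+L≤N) dense⁺ (begin
      N                ≤⟨ long ⟩
      m ^ j * L        ≤⟨ *-monoʳ-≤ (m ^ j) L≤ml ⟩
      m ^ j * (m * l)  ≡⟨ x∙yz≈y∙xz (m ^ j) m l ⟩
      m * (m ^ j * l)  ≡⟨ *-assoc m (m ^ j) l ⟨
      m ^ suc j * l    ∎)
    where open ≤-Reasoning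

  candidate : Candidate
  candidate = iterate {j = 0} (<-wellFounded N) ≤-refl denseWhole (≤-reflexive (sym (*-identityˡ N)))
    where
    denseWhole : DenseAt 0 0 N
    denseWhole = subst (λ c → ∣ A ∣ * 1 * N ≤ N * 1 * c) (sym (cnt-whole A))
                       (≤-reflexive (trans (*-comm (∣ A ∣ * 1) N) (x∙yz≈xz∙y N ∣ A ∣ 1)))

length-bound : ∀ {a N L m g} j p q .{{_ : NonZero g}} → m ^ q * g ^ p ≤ m ^ p →
              a * m ^ j ≤ N * g ^ j → N ≤ m ^ j * L → a ^ p * N ^ q ≤ L ^ q * N ^ p
length-bound {a} {N} {L} {m} {g} j p q base density long = begin
  a ^ p * N ^ q            ≤⟨ *-monoʳ-≤ (a ^ p) (^-monoˡ-≤ q long) ⟩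
  a ^ p * (M * L) ^ q      ≡⟨ cong (a ^ p *_) (^-distribʳ-* M L q) ⟩
  a ^ p * (M ^ q * L ^ q)  ≡⟨ x∙yz≈z∙xy (a ^ p) (M ^ q) (L ^ q) ⟩
  L ^ q * (a ^ p * M ^ q)  ≤⟨ *-monoʳ-≤ (L ^ q) a^p*M^q≤N^p ⟩
  L ^ q * N ^ p            ∎
  where
  open ≤-Reasoning
  M = m ^ j
  G = g ^ j
  instance
    _ = m^n≢0 g j
    _ = m^n≢0 G p
  M^q*G^p≤M^p : M ^ q * G ^ p ≤ M ^ p
  M^q*G^p≤M^p = begin
    (m ^ j) ^ q * (g ^ j) ^ p  ≡⟨ cong₂ _*_ ([m^n]^o≡[m^o]^n m j q) ([m^n]^o≡[m^o]^n g j p) ⟩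
    (m ^ q) ^ j * (g ^ p) ^ j  ≡⟨ ^-distribʳ-* (m ^ q) (g ^ p) j ⟨
    (m ^ q * g ^ p) ^ j        ≤⟨ ^-monoˡ-≤ j base ⟩
    (m ^ p) ^ j                ≡⟨ [m^n]^o≡[m^o]^n m p j ⟩
    (m ^ j) ^ p                ∎
  a^p*M^q≤N^p : a ^ p * M ^ q ≤ N ^ p
  a^p*M^q≤N^p = *-cancelʳ-≤ _ _ (G ^ p) (begin
    a ^ p * M ^ q * G ^ p    ≡⟨ *-assoc (a ^ p) (M ^ q) (G ^ p) ⟩
    a ^ p * (M ^ q * G ^ p)  ≤⟨ *-monoʳ-≤ (a ^ p) M^q*G^p≤M^p ⟩
    a ^ p * M ^ p            ≡⟨ ^-distribʳ-* a M p ⟨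
    (a * M) ^ p              ≤⟨ ^-monoˡ-≤ p density ⟩
    (N * G) ^ p              ≡⟨ ^-distribʳ-* N G p ⟩
    N ^ p * G ^ p            ∎)

lemma7 : (N k : ℕ) (A : Subset N) → 1 ≤ ∣ A ∣ → 2 ≤ k →
    ∃[ a ] ∃[ L ] (a + L ≤ N × Equidistributed A k a L ×
      ((p q : ℕ) → 1 ≤ q → ExpExceeds (4 * k) p q →
        ∣ A ∣ ^ p * N ^ q ≤ L ^ q * N ^ p))
lemma7 N k A 1≤∣A∣ 2≤k@(s≤s (s≤s _)) =
  let (a , L , j , a+L≤N , equidistributedAL , dense , long) = candidate
  in  a , L , a+L≤N , equidistributedAL , λ p q 1≤q exceeds →
        length-bound j p q (ExpExceeds⇒[1+g]^q*g^p≤[1+g]^p p q {{_}} {{>-nonZero 1≤q}} exceeds)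
                    (denseAt⇒density-bound {j} dense long) long
  where
  instance _ = >-nonZero 1≤∣A∣
  open DensityIncrement A k (pred (4 * k)) 2≤k ≤-refl
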